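{- Let $\mathcal{A}=(Q,P,M,R)$ be an ACS with $Q=\{q_1,\dots,q_x\}$, $P=\{p_1,\dots,p_y\}$, $M=\{m_1,\dots,m_z\}$, and let $c_{\mathcal{A}_0}$ be a place of $\mathcal{A}$. Suppose $c_{\mathcal{A}}=(u_{\mathcal{A}},v_{\mathcal{A}})$ is a place with $c_{\mathcal{A}_0}\Rightarrow^{*}c_{\mathcal{A}}$, $u_{\mathcal{A}}[q_i]=k_i$ for $1\le i\le x$, and $v_{\mathcal{A}}[(p_i,m_j)]=h_{ij}$ for all $1\le i\le y$, $1\le j\le z$. Then there exists a place $c_{\mathcal{B}}=(u_{\mathcal{B}},v_{\mathcal{B}})$ of the BPP $\mathcal{B}$ associated to $\mathcal{A}$ such that $u_{\mathcal{B}}[q_i]=k_i$ for all $i$, $v_{\mathcal{B}}[(p_i,m_j^{in})]=r_{ij}$ and $v_{\mathcal{B}}[(p_i,m_j^{out})]=s_{ij}$ with $r_{ij}-s_{ij}=h_{ij}$ for all $i,j$, and $c_{\mathcal{B}_0}\to^{\star}c_{\mathcal{B}}$ in $\mathcal{B}$, where $c_{\mathcal{B}_0}$ is the image of $c_{\mathcal{A}_0}$ under the place convert function.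
   Context: An Actor Communicating System (ACS) is a tuple $(Q,P,M,R)$ with $Q$ a finite set of control states, $P$ a finite set of processes, $M$ a finite set of messages, and $R$ a finite set of rules $q_1\xrightarrow{op}q_2$ with $q_1,q_2\in Q$ and $op\in\{nop,\ \nu q_3\ (q_3\in Q),\ p!m,\ p?m\ (p\in P,m\in M)\}$. A place of $\mathcal{A}$ is a pair $(u,v)$ with $u\in\mathbb{N}^{Q}$ (number of processes in each control state) and $v\in\mathbb{N}^{P\times M}$ ($v[(p,m)]$ = number of messages $m$ in $p$'s mailbox). A rule $q_1\xrightarrow{op}q_2$ is enabled at $(u,v)$ if $u[q_1]\ge1$ (and, for $op=p?m$, $v[(p,m)]\ge1$); firing it decrements $u[q_1]$, increments $u[q_2]$, and additionally: for $\nu q_3$ increments $u[q_3]$; for $p!m$ increments $v[(p,m)]$; for $p?m$ decrements $v[(p,m)]$; $nop$ has no further effect. $\Rightarrow^{*}$ is the reflexive transitive closure of the one-step relation. The associated BPP $\mathcal{B}=(V,\Delta)$ has symbols $V=Q\cup(P\times M\times\{in,out\})$ (writing $(p,m^{in})$, $(p,m^{out})$) and, for each rule $q_1\xrightarrow{op}q_2\in R$, a rule: $q_1\to q_2$ if $op=nop$; $q_1\to q_2\,q_3$ if $op=\nu q_3$; $q_1\to q_2\,(p,m^{in})$ if $op=p!m$; $q_1\to q_2\,(p,m^{out})$ if $op=p?m$. A place of $\mathcal{B}$ is $(u_{\mathcal{B}},v_{\mathcal{B}})$ with $u_{\mathcal{B}}\in\mathbb{N}^Q$, $v_{\mathcal{B}}\in\mathbb{N}^{P\times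 M\times\{in,out\}}$, i.e. a multiset over $V$; a BPP rule $X\to\alpha$ applies when the count of $X$ is at least $1$, removing one $X$ and adding $\alpha$; $\to^{\star}$ is its reflexive transitive closure. The place convert function maps a place $(u_{\mathcal{A}},v_{\mathcal{A}})$ of $\mathcal{A}$ to $(u_{\mathcal{B}},v_{\mathcal{B}})$ with $u_{\mathcal{B}}[q]=u_{\mathcal{A}}[q]$ for all $q\in Q$, $v_{\mathcal{B}}[(p,m^{in})]=v_{\mathcal{A}}[(p,m)]$ and $v_{\mathcal{B}}[(p,m^{out})]=0$ for all $p\in P,m\in M$. -}

module Defs where

open import Data.Nat using (ℕ; zero; suc; _+_; _∸_; _≥_)
open import Data.Fin using (Fin; _≟_)
open import Data.List using (List)
import Data.List
open import Data.List.Membership.Propositional using (_∈_)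
open import Data.Unit using (⊤)
open import Data.Product using (_×_; _,_; Σ; ∃)
open import Relation.Nullary using (yes; no)
open import Relation.Binary.PropositionalEquality using (_≡_)
open import Relation.Binary.Construct.Closure.ReflexiveTransitive using (Star)

-- Operations of an ACS rule, with Q = Fin x, P = Fin y, M = Fin z.
data Op (x y z : ℕ) : Set where
  nop  : Op x y z
  new  : Fin x → Op x y z
  send : Fin y → Fin z → Op x y z
  recv : Fin y → Fin z → Op x y z

record Rule (x y z : ℕ) : Set where
  constructor rule
  field
    src : Fin x
    op  : Op x y z
    tgt : Fin x

record ACS (x y z : ℕ) : Set where
  constructor acs
  field
    rules : List (Rule x y z)

inc : ∀ {n} → Fin n → (Fin n → ℕ) → (Fin n → ℕ)
inc i f j with i ≟ j
... | yes _ = suc (f j)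
... | no  _ = f j

dec : ∀ {n} → Fin n → (Fin n → ℕ) → (Fin n → ℕ)
dec i f j with i ≟ j
... | yes _ = f j ∸ 1
... | no  _ = f j

inc₂ : ∀ {m n} → Fin m → Fin n → (Fin m → Fin n → ℕ) → (Fin m → Fin n → ℕ)
inc₂ p q f a b with p ≟ a | q ≟ b
... | yes _ | yes _ = suc (f a b)
... | _     | _     = f a b

dec₂ : ∀ {m n} → Fin m → Fin n → (Fin m → Fin n → ℕ) → (Fin m → Fin n → ℕ)
dec₂ p q f a b with p ≟ a | q ≟ b
... | yes _ | yes _ = f a b ∸ 1
... | _     | _     = f a b

record PlaceA (x y z : ℕ) : Set where
  constructor placeA
  field
    u : Fin x → ℕ
    v : Fin y → Fin z → ℕ
open PlaceA public

-- effect of firing (guards are in StepA)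
fireA : ∀ {x y z} → Rule x y z → PlaceA x y z → PlaceA x y z
fireA (rule q₁ nop q₂)        (placeA u v) = placeA (inc q₂ (dec q₁ u)) v
fireA (rule q₁ (new q₃) q₂)   (placeA u v) = placeA (inc q₃ (inc q₂ (dec q₁ u))) v
fireA (rule q₁ (send p m) q₂) (placeA u v) = placeA (inc q₂ (dec q₁ u)) (inc₂ p m v)
fireA (rule q₁ (recv p m) q₂) (placeA u v) = placeA (inc q₂ (dec q₁ u)) (dec₂ p m v)

Guard : ∀ {x y z} → Rule x y z → PlaceA x y z → Set
Guard (rule _ (recv p m) _) c = v c p m ≥ 1
Guard _ _ = ⊤

data StepA {x y z} (A : ACS x y z) : PlaceA x y z → PlaceA x y z → Set where
  fire : ∀ {c} (r : Rule x y z) → r ∈ ACS.rules A →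
         u c (Rule.src r) ≥ 1 → Guard r c → StepA A c (fireA r c)

_⊢_⇒*_ : ∀ {x y z} → ACS x y z → PlaceA x y z → PlaceA x y z → Set
A ⊢ c ⇒* c' = Star (StepA A) c c'

-- Places of the associated BPP: multiset over V = Q ∪ (P × M × {in,out})
record PlaceB (x y z : ℕ) : Set where
  constructor placeB
  field
    uB    : Fin x → ℕ
    vBin  : Fin y → Fin z → ℕ
    vBout : Fin y → Fin z → ℕ
open PlaceB public

data Sym (x y z : ℕ) : Set where
  st   : Fin x → Sym x y z
  msgIn  : Fin y → Fin z → Sym x y z
  msgOut : Fin y → Fin z → Sym x y z

-- BPP rules X → α with X a control state (all rules of the associated BPP have this shape)
data BRule (x y z : ℕ) : Set where
  brule₁ : Fin x → Fin x → BRule x y z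
  brule₂ : Fin x → Fin x → Sym x y z → BRule x y z

toBRule : ∀ {x y z} → Rule x y z → BRule x y z
toBRule (rule q₁ nop q₂)        = brule₁ q₁ q₂
toBRule (rule q₁ (new q₃) q₂)   = brule₂ q₁ q₂ (st q₃)
toBRule (rule q₁ (send p m) q₂) = brule₂ q₁ q₂ (msgIn p m)
toBRule (rule q₁ (recv p m) q₂) = brule₂ q₁ q₂ (msgOut p m)

BPP : ℕ → ℕ → ℕ → Set
BPP x y z = List (BRule x y z)

assocBPP : ∀ {x y z} → ACS x y z → BPP x y z
assocBPP A = Data.List.map toBRule (ACS.rules A)

addSym : ∀ {x y z} → Sym x y z → PlaceB x y z → PlaceB x y z
addSym (st q)       (placeB a b c) = placeB (inc q a) b c
addSym (msgIn p m)  (placeB a b c) = placeB a (inc₂ p m b) c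
addSym (msgOut p m) (placeB a b c) = placeB a b (inc₂ p m c)

fireB : ∀ {x y z} → BRule x y z → PlaceB x y z → PlaceB x y z
fireB (brule₁ q₁ q₂) (placeB a b c) = placeB (inc q₂ (dec q₁ a)) b c
fireB (brule₂ q₁ q₂ X) (placeB a b c) = addSym X (placeB (inc q₂ (dec q₁ a)) b c)

lhsB : ∀ {x y z} → BRule x y z → Fin x
lhsB (brule₁ q₁ _) = q₁
lhsB (brule₂ q₁ _ _) = q₁

data StepB {x y z} (B : BPP x y z) : PlaceB x y z → PlaceB x y z → Set where
  fire : ∀ {c} (δ : BRule x y z) → δ ∈ B → uB c (lhsB δ) ≥ 1 → StepB B c (fireB δ c)

_⊢_→⋆_ : ∀ {x y z} → BPP x y z → PlaceB x y z → PlaceB x y z → Set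
B ⊢ c →⋆ c' = Star (StepB B) c c'

convert : ∀ {x y z} → PlaceA x y z → PlaceB x y z
convert (placeA u v) = placeB u v (λ _ _ → 0)

module Submission where

open import Defs
open import Data.Nat using (ℕ; suc; _+_; _∸_; _≥_)
open import Data.Nat.Properties using (+-suc; m≤m+n; m+n∸m≡n)
open import Data.Integer using (+_; _-_; _⊖_)
open import Data.Integer.Properties using ([+m]-[+n]≡m⊖n; ⊖-≥)
open import Data.Fin using (Fin; _≟_)
open import Data.Product using (Σ; _×_; _,_)
open import Relation.Nullary using (yes; no)
open import Relation.Binary.PropositionalEquality
open import Relation.Binary.Construct.Closure.ReflexiveTransitive using (ε; _◅_)
open import Data.List.Membership.Propositional.Properties using (∈-map⁺)

-- The BPP never consumes a message: a receive produces an m^out token instead.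
-- So a BPP place tracks an ACS place when the control states agree and every
-- mailbox count v[(p,m)] is the surplus of m^in tokens over m^out tokens.
-- The converted initial place is tracked (no m^out tokens yet), and each ACS step
-- is matched by its image rule in the BPP, whose firing preserves tracking.

Splits : ∀ {m n} → (Fin m → Fin n → ℕ) → (Fin m → Fin n → ℕ) → (Fin m → Fin n → ℕ) → Set
Splits b o w = ∀ a j → b a j ≡ o a j + w a j

Tracks : ∀ {x y z} → PlaceA x y z → PlaceB x y z → Set
Tracks c cB = uB cB ≗ u c × Splits (vBin cB) (vBout cB) (v c)

convert-tracks : ∀ {x y z} (c : PlaceA x y z) → Tracks c (convert c)
convert-tracks c = (λ _ → refl) , (λ _ _ → refl)

inc-resp-≗ : ∀ {n} (q : Fin n) {f g : Fin n → ℕ} → f ≗ g → inc q f ≗ inc q g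
inc-resp-≗ q f≗g j with q ≟ j
... | yes _ = cong suc (f≗g j)
... | no  _ = f≗g j

dec-resp-≗ : ∀ {n} (q : Fin n) {f g : Fin n → ℕ} → f ≗ g → dec q f ≗ dec q g
dec-resp-≗ q f≗g j with q ≟ j
... | yes _ = cong (_∸ 1) (f≗g j)
... | no  _ = f≗g j

inc₂-splits : ∀ {m n} (p : Fin m) (q : Fin n) {b o w} →
  Splits b o w → Splits (inc₂ p q b) o (inc₂ p q w)
inc₂-splits p q {o = o} {w} b≡o+w a j with p ≟ a | q ≟ j
... | yes _ | yes _ = trans (cong suc (b≡o+w a j)) (sym (+-suc (o a j) (w a j)))
... | yes _ | no  _ = b≡o+w a j
... | no  _ | _     = b≡o+w a j

move-splits : ∀ {m n} (p : Fin m) (q : Fin n) {b o w} → w p q ≥ 1 →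
  Splits b o w → Splits b (inc₂ p q o) (dec₂ p q w)
move-splits p q {o = o} {w} w≥1 b≡o+w a j with p ≟ a | q ≟ j
move-splits p q {o = o} {w} w≥1 b≡o+w a j | yes refl | yes refl with w p q | b≡o+w p q
... | suc t | b≡o+suc-t = trans b≡o+suc-t (+-suc (o p q) t)
move-splits p q w≥1 b≡o+w a j | yes _ | no _ = b≡o+w a j
move-splits p q w≥1 b≡o+w a j | no  _ | _    = b≡o+w a j

lhsB-toBRule : ∀ {x y z} (r : Rule x y z) → lhsB (toBRule r) ≡ Rule.src r
lhsB-toBRule (rule _ nop        _) = refl
lhsB-toBRule (rule _ (new _)    _) = refl
lhsB-toBRule (rule _ (send _ _) _) = refl
lhsB-toBRule (rule _ (recv _ _) _) = refl

fire-tracks : ∀ {x y z} (r : Rule x y z) {c cB} → Guard r c →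
  Tracks c cB → Tracks (fireA r c) (fireB (toBRule r) cB)
fire-tracks (rule q₁ nop q₂) _ (u≗ , vs) =
  inc-resp-≗ q₂ (dec-resp-≗ q₁ u≗) , vs
fire-tracks (rule q₁ (new q₃) q₂) _ (u≗ , vs) =
  inc-resp-≗ q₃ (inc-resp-≗ q₂ (dec-resp-≗ q₁ u≗)) , vs
fire-tracks (rule q₁ (send p m) q₂) _ (u≗ , vs) =
  inc-resp-≗ q₂ (dec-resp-≗ q₁ u≗) , inc₂-splits p m vs
fire-tracks (rule q₁ (recv p m) q₂) msg≥1 (u≗ , vs) =
  inc-resp-≗ q₂ (dec-resp-≗ q₁ u≗) , move-splits p m msg≥1 vs

step-simulation : ∀ {x y z} {A : ACS x y z} {c c' cB} → StepA A c c' → Tracks c cB →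
  Σ (PlaceB x y z) λ cB' → Tracks c' cB' × StepB (assocBPP A) cB cB'
step-simulation {cB = cB} (fire r r∈A src≥1 guard) tr@(u≗ , _) =
  fireB (toBRule r) cB , fire-tracks r guard tr ,
  fire (toBRule r) (∈-map⁺ toBRule r∈A) lhs≥1
  where
  lhs≥1 : uB cB (lhsB (toBRule r)) ≥ 1
  lhs≥1 = subst (_≥ 1) (sym (trans (cong (uB cB) (lhsB-toBRule r)) (u≗ (Rule.src r)))) src≥1

run-simulation : ∀ {x y z} {A : ACS x y z} {c c' cB} → A ⊢ c ⇒* c' → Tracks c cB →
  Σ (PlaceB x y z) λ cB' → Tracks c' cB' × (assocBPP A ⊢ cB →⋆ cB')
run-simulation {cB = cB} ε tr = cB , tr , ε
run-simulation (s ◅ ss) tr with step-simulation s tr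
... | cB₁ , tr₁ , s′ with run-simulation ss tr₁
...   | cB₂ , tr₂ , ss′ = cB₂ , tr₂ , (s′ ◅ ss′)

+-surplus : ∀ {a o w} → a ≡ o + w → (+ a) - (+ o) ≡ + w
+-surplus {o = o} {w} refl = begin
  + (o + w) - + o  ≡⟨ [+m]-[+n]≡m⊖n (o + w) o ⟩
  (o + w) ⊖ o      ≡⟨ ⊖-≥ (m≤m+n o w) ⟩
  + (o + w ∸ o)    ≡⟨ cong +_ (m+n∸m≡n o w) ⟩
  + w              ∎
  where open ≡-Reasoning

theorem5 : ∀ {x y z} (A : ACS x y z) (c₀ c : PlaceA x y z)
    (k : Fin x → ℕ) (h : Fin y → Fin z → ℕ) →
    A ⊢ c₀ ⇒* c →
    (∀ i → u c i ≡ k i) →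
    (∀ i j → v c i j ≡ h i j) →
    Σ (PlaceB x y z) λ cB →
    (∀ i → uB cB i ≡ k i) ×
    (∀ i j → (+ vBin cB i j) - (+ vBout cB i j) ≡ + h i j) ×
    (assocBPP A ⊢ convert c₀ →⋆ cB)
theorem5 A c₀ c k h run u≡k v≡h
  with run-simulation run (convert-tracks c₀)
... | cB , (u≗ , vs) , runB =
  cB ,
  (λ i → trans (u≗ i) (u≡k i)) ,
  (λ i j → +-surplus (trans (vs i j) (cong (λ n → vBout cB i j + n) (v≡h i j)))) ,
  runB
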